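{- Let $n\ge 6$ and let $T$ be a tree on $n$ vertices. Then $T$ contains a vertex $x$ whose neighbours can be enumerated as $v_1,\ldots,v_k$ (these being all neighbours of $x$) such that $|T_x(xv_k)| \ge 2\lceil\sqrt{n}\rceil-1$ and $|T_{v_i}(xv_i)| < 2\lceil\sqrt{n}\rceil-1$ for every $i\in\{1,\ldots,k-1\}$.
   Context: For a bridge $xy$ of a graph $G$ (in a tree every edge is a bridge), $G_x(xy)$ denotes the connected component containing $x$ of the graph obtained from $G$ by deleting the edge $xy$; $|H|$ denotes the number of vertices of a graph $H$. -}

module Defs where

open import Data.Nat using (ℕ; zero; suc; _+_; _*_; _≤_)
open import Data.Fin using (Fin; zero; suc; inject₁; fromℕ)
open import Data.Fin.Subset using (Subset; _∈_; ∣_∣)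
open import Data.Product using (Σ; _×_; ∃)
open import Relation.Binary.PropositionalEquality using (_≡_)
open import Relation.Nullary using (¬_)
open import Function.Definitions using (Injective)
open import Function.Bundles using (_⇔_)

record SimpleGraph (n : ℕ) : Set₁ where
  field
    Adj   : Fin n → Fin n → Set
    sym   : ∀ {u v} → Adj u v → Adj v u
    irrefl : ∀ {u} → ¬ Adj u u
open SimpleGraph public

data Walk {n : ℕ} (R : Fin n → Fin n → Set) : Fin n → Fin n → Set where
  nil  : ∀ {u} → Walk R u u
  cons : ∀ {u v w} → R u v → Walk R v w → Walk R u w

Connected : ∀ {n} → SimpleGraph n → Set
Connected G = ∀ u v → Walk (Adj G) u v

-- A cycle: k+3 ≥ 3 distinct vertices c₀,…,c_{k+2}, consecutive ones adjacent,
-- and the last adjacent to the first.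
Cycle : ∀ {n} → SimpleGraph n → Set
Cycle {n} G = Σ ℕ λ k → Σ (Fin (suc (suc (suc k))) → Fin n) λ c →
  Injective _≡_ _≡_ c
  × (∀ (i : Fin (suc (suc k))) → Adj G (c (inject₁ i)) (c (suc i)))
  × Adj G (c (fromℕ (suc (suc k)))) (c zero)

Acyclic : ∀ {n} → SimpleGraph n → Set
Acyclic G = ¬ Cycle G

IsTree : ∀ {n} → SimpleGraph n → Set
IsTree G = Connected G × Acyclic G

AdjMinus : ∀ {n} → SimpleGraph n → Fin n → Fin n → Fin n → Fin n → Set
AdjMinus G x y a b = Adj G a b × ¬ (a ≡ x × b ≡ y) × ¬ (a ≡ y × b ≡ x)

-- CompSize G x y m : |G_x(xy)| = m, i.e. the vertex set of the component
-- containing x of G - xy has exactly m elements.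
CompSize : ∀ {n} → SimpleGraph n → Fin n → Fin n → ℕ → Set
CompSize {n} G x y m = Σ (Subset n) λ S →
  (∀ z → (z ∈ S) ⇔ Walk (AdjMinus G x y) x z) × ∣ S ∣ ≡ m

IsCeilSqrt : ℕ → ℕ → Set
IsCeilSqrt n s = n ≤ s * s × (∀ t → n ≤ t * t → s ≤ t)

module Submission where

-- Write |x→y| for |T_x(xy)| and B = 2⌈√n⌉ − 1. If x ~ y and w ≠ y is another
-- neighbour of x, then T_w(wx) ⊊ T_x(xy) (x lies in the second but not the first),
-- so |w→x| < |x→y|. Starting from an oriented edge with |x→y| ≥ B and stepping to
-- a neighbour w ≠ y of x with |w→x| ≥ B while one exists, we stop at an edge xy
-- where all other neighbours of x see components smaller than B; listing them
-- first and y last gives the required enumeration. A starting edge exists: from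
-- the neighbour of a leaf one sees n − 1 ≥ B vertices, since 2⌈√n⌉ ≤ n for n ≥ 6,
-- and a leaf is found by the same descent with the trivial threshold.

open import Defs
open import Data.Nat using (ℕ; zero; suc; _+_; _*_; _∸_; _≤_; _<_; z≤n; s≤s; _≤?_)
open import Data.Nat.Properties
  using (≤-trans; ≤-<-trans; <⇒≤; n≤1+n; m≤m+n; 1+n≰n; ≰⇒>; ∸-monoˡ-≤; ∸-monoʳ-≤; m∸[m∸n]≡n)
open import Data.Nat.Induction using (<-wellFounded)
open import Data.Nat.Tactic.RingSolver using (solve-∀)
open import Data.Fin using (Fin; zero; suc; inject₁; fromℕ; _≟_)
open import Data.Fin.Properties using (any?; injective⇒≤)
open import Data.Fin.Relation.Unary.Top using (view; ‵fromℕ; ‵inject₁)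
open import Data.Fin.Subset using (Subset; _∈_; ∣_∣; ⁅_⁆; ∁; _⊆_)
open import Data.Fin.Subset.Properties using (∣p∣≤n; p⊂q⇒∣p∣<∣q∣; p⊆q⇒∣p∣≤∣q∣; ∣∁p∣≡n∸∣p∣; x∈∁p⇒x∉p; x∈⁅x⁆; ∣⁅x⁆∣≡1)
import Data.List as List
open import Data.List using (List)
open import Data.List.Membership.Propositional.Properties using (∈-filter⁺; ∈-filter⁻; ∈-allFin; ∈-lookup)
open import Data.List.Relation.Unary.Any using (index)
open import Data.List.Relation.Unary.Any.Properties using (lookup-index)
import Data.List.Relation.Unary.All as All
open import Data.List.Relation.Unary.Unique.Propositional using (Unique; _∷_)
open import Data.List.Relation.Unary.Unique.Propositional.Properties using (filter⁺; allFin⁺)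
open import Data.Vec using (tabulate)
open import Data.Vec.Properties using (lookup∘tabulate; []=⇒lookup; lookup⇒[]=)
open import Data.Bool using (true)
open import Data.Product using (Σ; _×_; ∃; ∃₂; _,_; proj₁; proj₂)
open import Data.Sum using (_⊎_; inj₁; inj₂)
open import Data.Unit using (⊤; tt)
open import Data.Empty using (⊥-elim)
open import Induction.WellFounded using (Acc; acc)
open import Relation.Nullary using (¬_; Dec; yes; no; ¬?; _×-dec_; _⊎-dec_; isYes)
open import Relation.Unary using (Decidable)
open import Relation.Binary.PropositionalEquality
  using (_≡_; _≢_; refl; trans; cong; subst) renaming (sym to ≡-sym)
open import Function.Definitions using (Injective)
open import Function.Bundles using (mk⇔)

module Walks {n : ℕ} {R : Fin n → Fin n → Set} where

  length : ∀ {u v} → Walk R u v → ℕ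
  length nil        = 0
  length (cons _ w) = suc (length w)

  vertex : ∀ {u v} (w : Walk R u v) → Fin (suc (length w)) → Fin n
  vertex {u} w          zero    = u
  vertex     (cons _ w) (suc i) = vertex w i

  infix 4 _∈ʷ_ _∈ʷ?_

  _∈ʷ_ : ∀ {u v} → Fin n → Walk R u v → Set
  _∈ʷ_ {u} x nil        = x ≡ u
  _∈ʷ_ {u} x (cons _ w) = x ≡ u ⊎ x ∈ʷ w

  _∈ʷ?_ : ∀ {u v} x (w : Walk R u v) → Dec (x ∈ʷ w)
  _∈ʷ?_ {u} x nil        = x ≟ u
  _∈ʷ?_ {u} x (cons _ w) = (x ≟ u) ⊎-dec (x ∈ʷ? w)

  IsPath : ∀ {u v} → Walk R u v → Set
  IsPath nil            = ⊤
  IsPath {u} (cons _ w) = ¬ (u ∈ʷ w) × IsPath w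

  source∈ʷ : ∀ {u v} (w : Walk R u v) → u ∈ʷ w
  source∈ʷ nil        = refl
  source∈ʷ (cons _ w) = inj₁ refl

  vertex∈ʷ : ∀ {u v} (w : Walk R u v) i → vertex w i ∈ʷ w
  vertex∈ʷ w          zero    = source∈ʷ w
  vertex∈ʷ (cons _ w) (suc i) = inj₂ (vertex∈ʷ w i)

  vertex-injective : ∀ {u v} (w : Walk R u v) → IsPath w → Injective _≡_ _≡_ (vertex w)
  vertex-injective w          _         {zero}  {zero}  _  = refl
  vertex-injective (cons _ w) (u∉w , _) {zero}  {suc j} eq = ⊥-elim (u∉w (subst (_∈ʷ w) (≡-sym eq) (vertex∈ʷ w j)))
  vertex-injective (cons _ w) (u∉w , _) {suc i} {zero}  eq = ⊥-elim (u∉w (subst (_∈ʷ w) eq (vertex∈ʷ w i)))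
  vertex-injective (cons _ w) (_ , p)   {suc i} {suc j} eq = cong suc (vertex-injective w p eq)

  vertex-last : ∀ {u v} (w : Walk R u v) → vertex w (fromℕ (length w)) ≡ v
  vertex-last nil        = refl
  vertex-last (cons _ w) = vertex-last w

  vertex-step : ∀ {u v} (w : Walk R u v) (i : Fin (length w)) → R (vertex w (inject₁ i)) (vertex w (suc i))
  vertex-step (cons e _) zero    = e
  vertex-step (cons _ w) (suc i) = vertex-step w i

  path-length≤ : ∀ {u v} (w : Walk R u v) → IsPath w → length w ≤ n
  path-length≤ w p = ≤-trans (n≤1+n _) (injective⇒≤ (vertex-injective w p))

  dropUntil : ∀ {u v x} (w : Walk R u v) → x ∈ʷ w → IsPath w → Σ (Walk R x v) IsPath
  dropUntil nil        refl       _       = nil , tt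
  dropUntil (cons e w) (inj₁ refl) p      = cons e w , p
  dropUntil (cons _ w) (inj₂ x∈w) (_ , p) = dropUntil w x∈w p

  takeUntil : ∀ {u v x} (w : Walk R u v) → x ∈ʷ w → Walk R u x
  takeUntil nil        refl        = nil
  takeUntil (cons _ _) (inj₁ refl) = nil
  takeUntil (cons e w) (inj₂ x∈w)  = cons e (takeUntil w x∈w)

  toPath : ∀ {u v} → Walk R u v → Σ (Walk R u v) IsPath
  toPath nil = nil , tt
  toPath {u} (cons e w) with toPath w
  ... | p , p-path with u ∈ʷ? p
  ...   | yes u∈p = dropUntil p u∈p p-path
  ...   | no  u∉p = cons e p , u∉p , p-path

  mapAvoiding : ∀ {R′ : Fin n → Fin n → Set} {x} →
    (∀ {a b} → R a b → a ≢ x → b ≢ x → R′ a b) →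
    ∀ {u v} (w : Walk R u v) → ¬ (x ∈ʷ w) → Walk R′ u v
  mapAvoiding f nil        _   = nil
  mapAvoiding f (cons e w) x∉w =
    cons (f e (λ eq → x∉w (inj₁ (≡-sym eq))) (λ eq → x∉w (inj₂ (subst (_∈ʷ w) eq (source∈ʷ w)))))
         (mapAvoiding f w (λ x∈w → x∉w (inj₂ x∈w)))

  module _ (R? : ∀ a b → Dec (R a b)) where

    walkWithin? : ∀ L a b → Dec (Σ (Walk R a b) λ w → length w ≤ L)
    walkWithin? L a b with a ≟ b
    ... | yes refl = yes (nil , z≤n)
    walkWithin? zero    a b | no a≢b = no λ { (nil , _) → a≢b refl ; (cons _ _ , ()) }
    walkWithin? (suc L) a b | no a≢b with any? (λ c → R? a c ×-dec walkWithin? L c b)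
    ... | yes (_ , e , w , w≤L) = yes (cons e w , s≤s w≤L)
    ... | no  none = no λ { (nil , _) → a≢b refl ; (cons e w , s≤s w≤L) → none (_ , e , w , w≤L) }

    -- Any walk shortens to a path, and paths have length at most n.
    walk? : ∀ a b → Dec (Walk R a b)
    walk? a b with walkWithin? n a b
    ... | yes (w , _) = yes w
    ... | no  none    = no λ w → none (proj₁ (toPath w) , path-length≤ (proj₁ (toPath w)) (proj₂ (toPath w)))

open Walks

lookup-injective : ∀ {A : Set} {xs : List A} → Unique xs → Injective _≡_ _≡_ (List.lookup xs)
lookup-injective (_   ∷ _) {zero}  {zero}  _  = refl
lookup-injective (x≢_ ∷ _) {zero}  {suc j} eq = ⊥-elim (All.lookup x≢_ (∈-lookup j) eq)
lookup-injective (x≢_ ∷ _) {suc i} {zero}  eq = ⊥-elim (All.lookup x≢_ (∈-lookup i) (≡-sym eq))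
lookup-injective (_   ∷ u) {suc i} {suc j} eq = cong suc (lookup-injective u eq)

Enumerates : ∀ {n k} → (Fin n → Set) → (Fin k → Fin n) → Set
Enumerates P v = Injective _≡_ _≡_ v × (∀ i → P (v i)) × (∀ z → P z → ∃ λ i → v i ≡ z)

enumerate : ∀ {n} {P : Fin n → Set} → Decidable P → ∃ λ k → Σ (Fin k → Fin n) (Enumerates P)
enumerate {n} P? =
  List.length xs , List.lookup xs , lookup-injective {xs = xs} (filter⁺ P? (allFin⁺ n)) ,
  (λ i → proj₂ (∈-filter⁻ P? {xs = List.allFin n} (∈-lookup i))) ,
  λ z pz → let z∈xs = ∈-filter⁺ P? (∈-allFin z) pz in index z∈xs , ≡-sym (lookup-index z∈xs)
  where xs = List.filter P? (List.allFin n)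

snoc : ∀ {k} {A : Set} → (Fin k → A) → A → Fin (suc k) → A
snoc {zero}  g a _       = a
snoc {suc k} g a zero    = g zero
snoc {suc k} g a (suc j) = snoc (λ i → g (suc i)) a j

snoc-fromℕ : ∀ {k} {A : Set} (g : Fin k → A) a → snoc g a (fromℕ k) ≡ a
snoc-fromℕ {zero}  g a = refl
snoc-fromℕ {suc k} g a = snoc-fromℕ (λ i → g (suc i)) a

snoc-inject₁ : ∀ {k} {A : Set} (g : Fin k → A) a i → snoc g a (inject₁ i) ≡ g i
snoc-inject₁ {suc k} g a zero    = refl
snoc-inject₁ {suc k} g a (suc i) = snoc-inject₁ (λ i → g (suc i)) a i

enumerateWithLast : ∀ {n} {P : Fin n → Set} → Decidable P → ∀ {y} → P y →
  ∃ λ k → Σ (Fin (suc k) → Fin n) λ v → Enumerates P v × v (fromℕ k) ≡ y × (∀ i → v (inject₁ i) ≢ y)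
enumerateWithLast {P = P} P? {y} py with enumerate (λ z → P? z ×-dec ¬? (z ≟ y))
... | k , u , u-injective , u-sound , u-complete =
  k , snoc u y , (v-injective , v-sound , v-complete) , snoc-fromℕ u y ,
  λ i v≡y → proj₂ (u-sound i) (trans (≡-sym (snoc-inject₁ u y i)) v≡y)
  where
  v-injective : Injective _≡_ _≡_ (snoc u y)
  v-injective {j₁} {j₂} with view j₁ | view j₂
  ... | ‵fromℕ      | ‵fromℕ       = λ _ → refl
  ... | ‵fromℕ      | ‵inject₁ i
    rewrite snoc-fromℕ u y | snoc-inject₁ u y i = λ y≡u → ⊥-elim (proj₂ (u-sound i) (≡-sym y≡u))
  ... | ‵inject₁ i | ‵fromℕ
    rewrite snoc-fromℕ u y | snoc-inject₁ u y i = λ u≡y → ⊥-elim (proj₂ (u-sound i) u≡y)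
  ... | ‵inject₁ i | ‵inject₁ i′
    rewrite snoc-inject₁ u y i | snoc-inject₁ u y i′ = λ u≡u → cong inject₁ (u-injective u≡u)

  v-sound : ∀ j → P (snoc u y j)
  v-sound j with view j
  ... | ‵fromℕ      rewrite snoc-fromℕ u y      = py
  ... | ‵inject₁ i rewrite snoc-inject₁ u y i = proj₁ (u-sound i)

  v-complete : ∀ z → P z → ∃ λ j → snoc u y j ≡ z
  v-complete z pz with z ≟ y
  ... | yes refl = fromℕ k , snoc-fromℕ u y
  ... | no  z≢y with u-complete z (pz , z≢y)
  ...   | i , u≡z = inject₁ i , trans (snoc-inject₁ u y i) u≡z

HasThresholdVertex : ∀ {n} → SimpleGraph n → ℕ → Set
HasThresholdVertex {n} T B =
  Σ (Fin n) λ x → Σ ℕ λ k → Σ (Fin (suc k) → Fin n) λ v →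
    Injective _≡_ _≡_ v
    × (∀ i → Adj T x (v i))
    × (∀ y → Adj T x y → ∃ λ i → v i ≡ y)
    × (∃ λ m → CompSize T x (v (fromℕ k)) m × B ≤ m)
    × (∀ (i : Fin k) → ∃ λ m → CompSize T (v (inject₁ i)) x m × m < B)

module Tree {n : ℕ} (T : SimpleGraph n) (tree : IsTree T) where

  connected : Connected T
  connected = proj₁ tree

  acyclic : Acyclic T
  acyclic = proj₂ tree

  cycleFromPath : ∀ {R : Fin n → Fin n → Set} → (∀ {a b} → R a b → Adj T a b) →
    ∀ {a b c d} (e₁ : R a b) (e₂ : R b c) (w : Walk R c d) →
    IsPath (cons e₁ (cons e₂ w)) → Adj T d a → Cycle T
  cycleFromPath R⊆T e₁ e₂ w p d~a =
    length w , vertex w′ , vertex-injective w′ p , (λ i → R⊆T (vertex-step w′ i)) ,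
    subst (λ z → Adj T z _) (≡-sym (vertex-last w′)) d~a
    where w′ = cons e₁ (cons e₂ w)

  adjacent? : ∀ u v → Dec (Adj T u v)
  adjacent? u v with toPath (connected u v)
  ... | nil , _                 = no (irrefl T)
  ... | cons e nil , _          = yes e
  ... | cons e (cons e′ w) , p = no λ u~v → acyclic (cycleFromPath (λ a → a) e e′ w p (sym T u~v))

  edge-is-bridge : ∀ {x y} → Adj T x y → ¬ Walk (AdjMinus T x y) x y
  edge-is-bridge x~y w with toPath w
  ... | nil , _                 = irrefl T x~y
  ... | cons e nil , _          = proj₁ (proj₂ e) (refl , refl)
  ... | cons e (cons e′ w′) , p = acyclic (cycleFromPath proj₁ e e′ w′ p (sym T x~y))

  adjacentMinus? : ∀ x y a b → Dec (AdjMinus T x y a b)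
  adjacentMinus? x y a b =
    adjacent? a b ×-dec ¬? ((a ≟ x) ×-dec (b ≟ y)) ×-dec ¬? ((a ≟ y) ×-dec (b ≟ x))

  component : Fin n → Fin n → Subset n
  component x y = tabulate (λ z → isYes (walk? (adjacentMinus? x y) x z))

  ∈-component⁻ : ∀ {x y z} → z ∈ component x y → Walk (AdjMinus T x y) x z
  ∈-component⁻ {x} {y} {z} z∈C
    with walk? (adjacentMinus? x y) x z | trans (≡-sym (lookup∘tabulate _ z)) ([]=⇒lookup z∈C)
  ... | yes w | _ = w
  ... | no  _ | ()

  ∈-component⁺ : ∀ {x y z} → Walk (AdjMinus T x y) x z → z ∈ component x y
  ∈-component⁺ {x} {y} {z} w = lookup⇒[]= z (component x y) (trans (lookup∘tabulate _ z) (isYes-walk w))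
    where
    isYes-walk : Walk (AdjMinus T x y) x z → isYes (walk? (adjacentMinus? x y) x z) ≡ true
    isYes-walk w with walk? (adjacentMinus? x y) x z
    ... | yes _ = refl
    ... | no ¬w = ⊥-elim (¬w w)

  componentSize : Fin n → Fin n → ℕ
  componentSize x y = ∣ component x y ∣

  componentSize-correct : ∀ x y → CompSize T x y (componentSize x y)
  componentSize-correct x y = component x y , (λ z → mk⇔ ∈-component⁻ ∈-component⁺) , refl

  -- T_w(wx) ⊆ T_x(xy) because a walk from w avoiding the edge wx never reaches x;
  -- x itself witnesses that the inclusion is strict.
  componentSize-step : ∀ {x y w} → Adj T x y → Adj T x w → w ≢ y → componentSize w x < componentSize x y
  componentSize-step {x} {y} {w} x~y x~w w≢y =
    p⊂q⇒∣p∣<∣q∣ (C⊆ , x , ∈-component⁺ nil , λ x∈C → edge-is-bridge (sym T x~w) (∈-component⁻ x∈C))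
    where
    C⊆ : component w x ⊆ component x y
    C⊆ z∈C = ∈-component⁺ (cons first (mapAvoiding shift walk x∉walk))
      where
      walk = ∈-component⁻ z∈C
      x∉walk = λ x∈walk → edge-is-bridge (sym T x~w) (takeUntil walk x∈walk)
      first : AdjMinus T x y x w
      first = x~w , (λ (_ , w≡y) → w≢y w≡y) , λ (_ , x≡x) → irrefl T (subst (Adj T x) x≡x x~w)
      shift : ∀ {a b} → AdjMinus T w x a b → a ≢ x → b ≢ x → AdjMinus T x y a b
      shift (a~b , _) a≢x b≢x = a~b , (λ (a≡x , _) → a≢x a≡x) , λ (_ , b≡x) → b≢x b≡x

  -- Every z ≠ x is reached from x by a path whose first step goes to y.
  leaf-componentSize : ∀ {x y} → (∀ w → Adj T x w → w ≡ y) → n ∸ 1 ≤ componentSize y x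
  leaf-componentSize {x} {y} leaf =
    subst (n ∸ 1 ≤_) (m∸[m∸n]≡n (∣p∣≤n (component y x))) (∸-monoʳ-≤ n outside≤1)
    where
    reached : ∀ z → z ≢ x → z ∈ component y x
    reached z z≢x with toPath (connected x z)
    ... | nil , _ = ⊥-elim (z≢x refl)
    ... | cons {v = b} x~b p , x∉p , _ =
      ∈-component⁺ (subst (λ t → Walk (AdjMinus T y x) t z) (leaf b x~b)
        (mapAvoiding (λ a~b a≢x b≢x → a~b , (λ (_ , b≡x) → b≢x b≡x) , λ (a≡x , _) → a≢x a≡x) p x∉p))
    ∁C⊆⁅x⁆ : ∁ (component y x) ⊆ ⁅ x ⁆
    ∁C⊆⁅x⁆ {z} z∉C with z ≟ x
    ... | yes refl = x∈⁅x⁆ x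
    ... | no  z≢x  = ⊥-elim (x∈∁p⇒x∉p z∉C (reached z z≢x))
    outside≤1 : n ∸ componentSize y x ≤ 1
    outside≤1 = subst (_≤ 1) (∣∁p∣≡n∸∣p∣ (component y x))
      (subst (∣ ∁ (component y x) ∣ ≤_) (∣⁅x⁆∣≡1 x) (p⊆q⇒∣p∣≤∣q∣ ∁C⊆⁅x⁆))

  Critical : (ℕ → Set) → Fin n → Fin n → Set
  Critical Q x y = Adj T x y × Q (componentSize x y) × (∀ w → Adj T x w → w ≢ y → ¬ Q (componentSize w x))

  critical-exists : ∀ {Q : ℕ → Set} → Decidable Q → ∀ {x y} → Adj T x y → Q (componentSize x y) → ∃₂ (Critical Q)
  critical-exists {Q} Q? x~y q = descend x~y q (<-wellFounded _)
    where
    descend : ∀ {x y} → Adj T x y → Q (componentSize x y) → Acc _<_ (componentSize x y) → ∃₂ (Critical Q)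
    descend {x} {y} x~y q (acc smaller)
      with any? (λ w → adjacent? x w ×-dec ¬? (w ≟ y) ×-dec Q? (componentSize w x))
    ... | yes (w , x~w , w≢y , qw) = descend (sym T x~w) qw (smaller (componentSize-step x~y x~w w≢y))
    ... | no  none                 = x , y , x~y , q , λ w x~w w≢y qw → none (w , x~w , w≢y , qw)

  leaf-exists : ∀ {a b : Fin n} → a ≢ b → ∃₂ λ x y → Adj T x y × (∀ w → Adj T x w → w ≡ y)
  leaf-exists {a} {b} a≢b with connected a b
  ... | nil      = ⊥-elim (a≢b refl)
  ... | cons e _ with critical-exists (λ _ → yes tt) e tt
  ...   | x , y , x~y , _ , others = x , y , x~y , only-y
    where
    only-y : ∀ w → Adj T x w → w ≡ y
    only-y w x~w with w ≟ y
    ... | yes w≡y = w≡y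
    ... | no  w≢y = ⊥-elim (others w x~w w≢y tt)

  thresholdVertex : ∀ {a b : Fin n} → a ≢ b → ∀ {B} → B ≤ n ∸ 1 → HasThresholdVertex T B
  thresholdVertex a≢b {B} B≤n∸1 with leaf-exists a≢b
  ... | ℓ , y₀ , ℓ~y₀ , ℓ-leaf
    with critical-exists (B ≤?_) (sym T ℓ~y₀) (≤-trans B≤n∸1 (leaf-componentSize ℓ-leaf))
  ... | x , y , x~y , large , small
    with enumerateWithLast (adjacent? x) x~y
  ... | k , v , (v-injective , v-adjacent , v-complete) , v-last , v≢y =
    x , k , v , v-injective , v-adjacent , v-complete ,
    (_ , componentSize-correct x _ , subst (λ t → B ≤ componentSize x t) (≡-sym v-last) large) ,
    λ i → _ , componentSize-correct (v (inject₁ i)) x , ≰⇒> (small _ (v-adjacent (inject₁ i)) (v≢y i))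

-- For s ≥ 4, minimality of s gives (s − 1)² < n, and 2s ≤ (s − 1)².
2*ceilSqrt≤ : ∀ {n s} → 6 ≤ n → IsCeilSqrt n s → 2 * s ≤ n
2*ceilSqrt≤ {s = 0} _   _ = z≤n
2*ceilSqrt≤ {s = 1} 6≤n _ = ≤-trans (m≤m+n 2 4) 6≤n
2*ceilSqrt≤ {s = 2} 6≤n _ = ≤-trans (m≤m+n 4 2) 6≤n
2*ceilSqrt≤ {s = 3} 6≤n _ = 6≤n
2*ceilSqrt≤ {s = suc (suc (suc (suc u)))} _ (_ , least) =
  <⇒≤ (≤-<-trans (subst (2 * (4 + u) ≤_) (≡-sym (square u)) (m≤m+n _ _))
                 (≰⇒> λ n≤[3+u]² → 1+n≰n (least (3 + u) n≤[3+u]²)))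
  where
  square : ∀ u → (3 + u) * (3 + u) ≡ 2 * (4 + u) + (1 + u * (4 + u))
  square = solve-∀

lemma2p1 : (n : ℕ) → 6 ≤ n → (T : SimpleGraph n) → IsTree T →
    (s : ℕ) → IsCeilSqrt n s →
    Σ (Fin n) λ x → Σ ℕ λ k → Σ (Fin (suc k) → Fin n) λ v →
      Injective _≡_ _≡_ v
      × (∀ i → Adj T x (v i))
      × (∀ y → Adj T x y → ∃ λ i → v i ≡ y)
      × (∃ λ m → CompSize T x (v (fromℕ k)) m × 2 * s ∸ 1 ≤ m)
      × (∀ (i : Fin k) → ∃ λ m → CompSize T (v (inject₁ i)) x m × m < 2 * s ∸ 1)
lemma2p1 0 () _ _ _ _
lemma2p1 1 (s≤s ()) _ _ _ _
lemma2p1 (suc (suc n)) 6≤n T tree s ceil =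
  Tree.thresholdVertex T tree {zero} {suc zero} (λ ()) (∸-monoˡ-≤ 1 (2*ceilSqrt≤ 6≤n ceil))
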